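{- Let $A_k(x)=\sum_{\pi\in\mathfrak{S}_k}x^{\mathrm{des}(\pi)}$ and define $\widetilde{A}_0(x)=1$, $\widetilde{A}_n(x)=1+x\sum_{k=1}^{n}\binom{n}{k}A_k(x)$ for $n\ge1$. Then for all $n\ge 1$, $$\widetilde{A}_{n+1}(x)=\bigl(1+(n+1)x\bigr)\widetilde{A}_n(x)+x(1-x)\widetilde{A}_n'(x)-nx\,\widetilde{A}_{n-1}(x).$$
   Context: $\mathfrak{S}_k$ is the symmetric group on $[k]$; $\mathrm{des}(\pi)$ is the number of $i\in[k-1]$ with $\pi(i)>\pi(i+1)$. $\widetilde{A}_n'(x)$ denotes the derivative in $x$. -}

module Defs where

open import Data.Nat using (ℕ; zero; suc; _<ᵇ_; _≟_)
open import Data.Nat.Combinatorics using (_C_)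
open import Data.Integer using (ℤ; +_; _+_; _-_; _*_)
open import Data.List using (List; []; _∷_; map; concatMap; upTo; filter; length)
open import Data.Bool using (if_then_else_)
open import Relation.Binary.PropositionalEquality using (_≡_)

-- Polynomials in x with integer coefficients, represented by their
-- coefficient sequences: p j is the coefficient of x^j.
Poly : Set
Poly = ℕ → ℤ

one : Poly
one zero    = + 1
one (suc _) = + 0

_⊕_ : Poly → Poly → Poly
(p ⊕ q) j = p j + q j

_⊖_ : Poly → Poly → Poly
(p ⊖ q) j = p j - q j

_·_ : ℤ → Poly → Poly
(c · p) j = c * p j

X : Poly → Poly
X p zero    = + 0
X p (suc j) = p j

deriv : Poly → Poly
deriv p j = + suc j * p (suc j)

Σ₁ : ℕ → (ℕ → Poly) → Poly
Σ₁ zero    f j = + 0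
Σ₁ (suc n) f j = Σ₁ n f j + f (suc n) j

insertions : ℕ → List ℕ → List (List ℕ)
insertions x []       = (x ∷ []) ∷ []
insertions x (y ∷ ys) = (x ∷ y ∷ ys) ∷ map (y ∷_) (insertions x ys)

perms : List ℕ → List (List ℕ)
perms []       = [] ∷ []
perms (x ∷ xs) = concatMap (insertions x) (perms xs)

-- the symmetric group S_k, each π listed in one-line notation
-- (π(1), …, π(k)) with values relabelled 0,…,k-1
Sym : ℕ → List (List ℕ)
Sym k = perms (upTo k)

des : List ℕ → ℕ
des []           = 0
des (a ∷ [])     = 0
des (a ∷ b ∷ r)  = (if b <ᵇ a then 1 else 0) Data.Nat.+ des (b ∷ r)

A : ℕ → Poly
A k j = + length (filter (λ π → des π ≟ j) (Sym k))

Ã : ℕ → Poly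
Ã zero    = one
Ã (suc m) = one ⊕ X (Σ₁ (suc m) (λ k → (+ (suc m C k)) · A k))

_≗ₚ_ : Poly → Poly → Set
p ≗ₚ q = ∀ j → p j ≡ q j

module Submission where

-- Inserting a new minimum into a permutation σ of length k gives k + 1 permutations: in the
-- front slot and in the des σ slots right after a descent the number of descents stays des σ,
-- in the other k − des σ slots it becomes des σ + 1. Hence the Eulerian numbers satisfy
-- A(k+1, i+1) = (i+2) A(k, i+1) + (k−i) A(k, i), i.e. A_{k+1} = (1+kx) A_k + x(1−x) A_k'.
-- Write Ã_n = 1 + x B_n with B_n = Σ_{k=1}^n C(n,k) A_k. Pascal's rule gives
-- B_{n+1} = B_n + A_1 + Σ_k C(n,k) A_{k+1}; the Eulerian recurrence expands the last sum, and
-- k C(n,k) = n C(n−1,k−1) turns its part Σ_k k C(n,k) A_k into n (B_n − B_{n−1}). The resulting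
-- recurrence for B_n is the theorem, compared coefficient by coefficient.

open import Defs

module Descents where

  open import Data.Nat using (ℕ; zero; suc; _+_; _*_; _<ᵇ_; _≟_)
  open import Data.Nat.Properties using (+-assoc; +-suc; *-zeroʳ; +-identityʳ)
  open import Data.Nat.Tactic.RingSolver using (solve-∀)
  open import Data.Bool using (true; false; if_then_else_)
  open import Data.List using (List; []; _∷_; _++_; map; concat; concatMap; filter; length; upTo)
  open import Data.List.Properties using (map-∘; map-cong; concat-map; map-upTo; length-++; filter-++; length-upTo)
  open import Data.List.Relation.Unary.All as All using (All; []; _∷_)
  open import Data.List.Relation.Unary.All.Properties using (map⁺; concat⁺)
  open import Relation.Nullary using (does; yes; no; ¬_)
  open import Relation.Nullary.Decidable using (dec-false)
  open import Relation.Binary.PropositionalEquality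
  open ≡-Reasoning
  open import Function using (_∘′_)

  insertions-map : ∀ (f : ℕ → ℕ) x ys → insertions (f x) (map f ys) ≡ map (map f) (insertions x ys)
  insertions-map f x []       = refl
  insertions-map f x (y ∷ ys) = cong ((f x ∷ f y ∷ map f ys) ∷_) (begin
    map (f y ∷_) (insertions (f x) (map f ys))     ≡⟨ cong (map (f y ∷_)) (insertions-map f x ys) ⟩
    map (f y ∷_) (map (map f) (insertions x ys))   ≡⟨ map-∘ (insertions x ys) ⟨
    map (λ w → f y ∷ map f w) (insertions x ys)    ≡⟨ map-∘ (insertions x ys) ⟩
    map (map f) (map (y ∷_) (insertions x ys))     ∎)

  perms-map : ∀ (f : ℕ → ℕ) xs → perms (map f xs) ≡ map (map f) (perms xs)
  perms-map f []       = refl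
  perms-map f (x ∷ xs) = begin
    concatMap (insertions (f x)) (perms (map f xs))            ≡⟨ cong (concatMap (insertions (f x))) (perms-map f xs) ⟩
    concat (map (insertions (f x)) (map (map f) (perms xs)))   ≡⟨ cong concat (map-∘ (perms xs)) ⟨
    concat (map (insertions (f x) ∘′ map f) (perms xs))        ≡⟨ cong concat (map-cong (insertions-map f x) (perms xs)) ⟩
    concat (map (map (map f) ∘′ insertions x) (perms xs))      ≡⟨ cong concat (map-∘ (perms xs)) ⟩
    concat (map (map (map f)) (map (insertions x) (perms xs))) ≡⟨ concat-map (map (insertions x) (perms xs)) ⟩
    map (map f) (concatMap (insertions x) (perms xs))          ∎

  insertMin : List ℕ → List (List ℕ)
  insertMin σ = insertions 0 (map suc σ)

  Sym-suc : ∀ k → Sym (suc k) ≡ concatMap insertMin (Sym k)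
  Sym-suc k = begin
    Sym (suc k)                                                  ≡⟨ cong (concatMap (insertions 0) ∘′ perms) (map-upTo suc k) ⟨
    concatMap (insertions 0) (perms (map suc (upTo k)))          ≡⟨ cong (concatMap (insertions 0)) (perms-map suc (upTo k)) ⟩
    concat (map (insertions 0) (map (map suc) (perms (upTo k)))) ≡⟨ cong concat (map-∘ (perms (upTo k))) ⟨
    concatMap insertMin (Sym k)                                  ∎

  insertions-length : ∀ x w {n} → length w ≡ n → All (λ v → length v ≡ suc n) (insertions x w)
  insertions-length x []       refl = refl ∷ []
  insertions-length x (y ∷ ys) refl = refl ∷ map⁺ (All.map (cong suc) (insertions-length x ys refl))

  perms-length : ∀ xs → All (λ σ → length σ ≡ length xs) (perms xs)
  perms-length []       = refl ∷ []
  perms-length (x ∷ xs) = concat⁺ (map⁺ (All.map (λ {σ} → insertions-length x σ) (perms-length xs)))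

  Sym-length : ∀ k → All (λ σ → length σ ≡ k) (Sym k)
  Sym-length k = subst (λ n → All (λ σ → length σ ≡ n) (Sym k)) (length-upTo k) (perms-length (upTo k))

  δ : ℕ → ℕ → ℕ
  δ d j = if does (d ≟ j) then 1 else 0

  δ-≢ : ∀ {d j} → ¬ d ≡ j → δ d j ≡ 0
  δ-≢ {d} {j} d≢j = cong (λ b → if b then 1 else 0) (dec-false (d ≟ j) d≢j)

  δ-weight : ∀ d j → d * δ d j ≡ j * δ d j
  δ-weight d j with d ≟ j
  ... | yes refl = refl
  ... | no  d≢j  = begin
    d * δ d j ≡⟨ cong (d *_) (δ-≢ d≢j) ⟩
    d * 0     ≡⟨ *-zeroʳ d ⟩
    0         ≡⟨ *-zeroʳ j ⟨
    j * 0     ≡⟨ cong (j *_) (δ-≢ d≢j) ⟨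
    j * δ d j ∎

  countDes : List (List ℕ) → ℕ → ℕ
  countDes L j = length (filter (λ π → des π ≟ j) L)

  countDes-∷ : ∀ π L j → countDes (π ∷ L) j ≡ δ (des π) j + countDes L j
  countDes-∷ π L j with does (des π ≟ j)
  ... | true  = refl
  ... | false = refl

  countDes-++ : ∀ xs ys j → countDes (xs ++ ys) j ≡ countDes xs j + countDes ys j
  countDes-++ xs ys j = trans (cong length (filter-++ (λ π → des π ≟ j) xs ys)) (length-++ (filter (λ π → des π ≟ j) xs))

  module _ (f g : List ℕ → List ℕ) where

    countDes-map : (∀ w → des (f w) ≡ des (g w)) → ∀ L j → countDes (map f L) j ≡ countDes (map g L) j
    countDes-map des-f []      j = refl
    countDes-map des-f (w ∷ L) j = begin
      countDes (f w ∷ map f L) j             ≡⟨ countDes-∷ (f w) (map f L) j ⟩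
      δ (des (f w)) j + countDes (map f L) j ≡⟨ cong₂ _+_ (cong (λ d → δ d j) (des-f w)) (countDes-map des-f L j) ⟩
      δ (des (g w)) j + countDes (map g L) j ≡⟨ countDes-∷ (g w) (map g L) j ⟨
      countDes (g w ∷ map g L) j             ∎

    countDes-map-suc : (∀ w → des (f w) ≡ suc (des (g w))) → ∀ L j → countDes (map f L) (suc j) ≡ countDes (map g L) j
    countDes-map-suc des-f []      j = refl
    countDes-map-suc des-f (w ∷ L) j = begin
      countDes (f w ∷ map f L) (suc j)                   ≡⟨ countDes-∷ (f w) (map f L) (suc j) ⟩
      δ (des (f w)) (suc j) + countDes (map f L) (suc j) ≡⟨ cong₂ _+_ (cong (λ d → δ d (suc j)) (des-f w)) (countDes-map-suc des-f L j) ⟩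
      δ (des (g w)) j + countDes (map g L) j             ≡⟨ countDes-∷ (g w) (map g L) j ⟨
      countDes (g w ∷ map g L) j                         ∎

    countDes-map-suc-zero : (∀ w → des (f w) ≡ suc (des (g w))) → ∀ L → countDes (map f L) 0 ≡ 0
    countDes-map-suc-zero des-f []      = refl
    countDes-map-suc-zero des-f (w ∷ L) = begin
      countDes (f w ∷ map f L) 0             ≡⟨ countDes-∷ (f w) (map f L) 0 ⟩
      δ (des (f w)) 0 + countDes (map f L) 0 ≡⟨ cong₂ _+_ (cong (λ d → δ d 0) (des-f w)) (countDes-map-suc-zero des-f L) ⟩
      0                                      ∎

  des-map-suc : ∀ σ → des (map suc σ) ≡ des σ
  des-map-suc []          = refl
  des-map-suc (a ∷ [])    = refl
  des-map-suc (a ∷ b ∷ r) = cong ((if b <ᵇ a then 1 else 0) +_) (des-map-suc (b ∷ r))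

  -- Non-descents of σ, the last position included: the slots where inserting
  -- a new minimum creates a descent.
  asc : List ℕ → ℕ
  asc []          = 0
  asc (a ∷ [])    = 1
  asc (a ∷ b ∷ r) = (if b <ᵇ a then 0 else 1) + asc (b ∷ r)

  des+asc≡length : ∀ σ → des σ + asc σ ≡ length σ
  des+asc≡length []          = refl
  des+asc≡length (a ∷ [])    = refl
  des+asc≡length (a ∷ b ∷ r) with b <ᵇ a | des+asc≡length (b ∷ r)
  ... | true  | ih = cong suc ih
  ... | false | ih = trans (+-suc (des (b ∷ r)) (asc (b ∷ r))) (cong suc ih)

  countDes-insertMin-cons : ∀ y z ζ j → countDes (map (suc y ∷_) (insertMin (z ∷ ζ))) j
                            ≡ δ (suc (des (z ∷ ζ))) j + countDes (map (λ w → suc y ∷ suc z ∷ w) (insertMin ζ)) j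
  countDes-insertMin-cons y z ζ j = begin
    countDes (map (suc y ∷_) (insertMin (z ∷ ζ))) j
      ≡⟨ countDes-∷ (suc y ∷ 0 ∷ suc z ∷ map suc ζ) (map (suc y ∷_) (map (suc z ∷_) (insertMin ζ))) j ⟩
    δ (suc (des (map suc (z ∷ ζ)))) j + countDes (map (suc y ∷_) (map (suc z ∷_) (insertMin ζ))) j
      ≡⟨ cong₂ (λ e L → δ (suc e) j + countDes L j) (des-map-suc (z ∷ ζ)) (sym (map-∘ (insertMin ζ))) ⟩
    δ (suc (des (z ∷ ζ))) j + countDes (map (λ w → suc y ∷ suc z ∷ w) (insertMin ζ)) j ∎

  countDes-insertMin-tail : ∀ y τ j → countDes (map (suc y ∷_) (insertMin τ)) j
                            ≡ des (y ∷ τ) * δ (des (y ∷ τ)) j + asc (y ∷ τ) * δ (suc (des (y ∷ τ))) j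
  countDes-insertMin-tail y []      j = countDes-∷ (suc y ∷ 0 ∷ []) [] j
  countDes-insertMin-tail y (z ∷ ζ) j with z <ᵇ y in z<?y
  ... | true  = trans (countDes-insertMin-cons y z ζ j) (after-descent j)
    where
    d = des (z ∷ ζ)
    a = asc (z ∷ ζ)
    des-prepend : ∀ w → des (suc y ∷ suc z ∷ w) ≡ suc (des (suc z ∷ w))
    des-prepend w = cong (λ b → (if b then 1 else 0) + des (suc z ∷ w)) z<?y
    after-descent : ∀ j → δ (suc d) j + countDes (map (λ w → suc y ∷ suc z ∷ w) (insertMin ζ)) j
                          ≡ suc d * δ (suc d) j + a * δ (suc (suc d)) j
    after-descent zero = begin
      countDes (map (λ w → suc y ∷ suc z ∷ w) (insertMin ζ)) 0 ≡⟨ countDes-map-suc-zero _ (suc z ∷_) des-prepend (insertMin ζ) ⟩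
      0                                                         ≡⟨ cong₂ _+_ (*-zeroʳ (suc d)) (*-zeroʳ a) ⟨
      suc d * 0 + a * 0                                         ∎
    after-descent (suc i) = begin
      δ d i + countDes (map (λ w → suc y ∷ suc z ∷ w) (insertMin ζ)) (suc i)
        ≡⟨ cong (δ d i +_) (countDes-map-suc _ (suc z ∷_) des-prepend (insertMin ζ) i) ⟩
      δ d i + countDes (map (suc z ∷_) (insertMin ζ)) i
        ≡⟨ cong (δ d i +_) (countDes-insertMin-tail z ζ i) ⟩
      δ d i + (d * δ d i + a * δ (suc d) i)
        ≡⟨ +-assoc (δ d i) _ _ ⟨
      suc d * δ d i + a * δ (suc d) i ∎
  ... | false = trans (countDes-insertMin-cons y z ζ j) after-ascent
    where
    d = des (z ∷ ζ)
    a = asc (z ∷ ζ)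
    des-prepend : ∀ w → des (suc y ∷ suc z ∷ w) ≡ des (suc z ∷ w)
    des-prepend w = cong (λ b → (if b then 1 else 0) + des (suc z ∷ w)) z<?y
    after-ascent : δ (suc d) j + countDes (map (λ w → suc y ∷ suc z ∷ w) (insertMin ζ)) j
                   ≡ d * δ d j + suc a * δ (suc d) j
    after-ascent = begin
      δ (suc d) j + countDes (map (λ w → suc y ∷ suc z ∷ w) (insertMin ζ)) j
        ≡⟨ cong (δ (suc d) j +_) (countDes-map _ (suc z ∷_) des-prepend (insertMin ζ) j) ⟩
      δ (suc d) j + countDes (map (suc z ∷_) (insertMin ζ)) j
        ≡⟨ cong (δ (suc d) j +_) (countDes-insertMin-tail z ζ j) ⟩
      δ (suc d) j + (d * δ d j + a * δ (suc d) j)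
        ≡⟨ x+[y+z]≡y+[x+z] (δ (suc d) j) (d * δ d j) (a * δ (suc d) j) ⟩
      d * δ d j + suc a * δ (suc d) j ∎
      where
      x+[y+z]≡y+[x+z] : ∀ x y z → x + (y + z) ≡ y + (x + z)
      x+[y+z]≡y+[x+z] = solve-∀

  countDes-insertMin : ∀ σ j → countDes (insertMin σ) j ≡ suc (des σ) * δ (des σ) j + asc σ * δ (suc (des σ)) j
  countDes-insertMin []      j = trans (countDes-∷ (0 ∷ []) [] j) (sym (+-identityʳ (δ 0 j + 0)))
  countDes-insertMin (y ∷ τ) j = begin
    countDes (insertMin (y ∷ τ)) j
      ≡⟨ countDes-∷ (0 ∷ suc y ∷ map suc τ) (map (suc y ∷_) (insertMin τ)) j ⟩
    δ (des (map suc (y ∷ τ))) j + countDes (map (suc y ∷_) (insertMin τ)) j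
      ≡⟨ cong₂ _+_ (cong (λ e → δ e j) (des-map-suc (y ∷ τ))) (countDes-insertMin-tail y τ j) ⟩
    δ d j + (d * δ d j + asc (y ∷ τ) * δ (suc d) j)
      ≡⟨ +-assoc (δ d j) _ _ ⟨
    suc d * δ d j + asc (y ∷ τ) * δ (suc d) j ∎
    where d = des (y ∷ τ)

  countDes-insertMin-zero : ∀ σ → countDes (insertMin σ) 0 ≡ δ (des σ) 0
  countDes-insertMin-zero σ = begin
    countDes (insertMin σ) 0          ≡⟨ countDes-insertMin σ 0 ⟩
    δ d 0 + d * δ d 0 + asc σ * 0     ≡⟨ cong₂ (λ u v → δ d 0 + u + v) (δ-weight d 0) (*-zeroʳ (asc σ)) ⟩
    δ d 0 + 0 + 0                     ≡⟨ trans (+-identityʳ _) (+-identityʳ _) ⟩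
    δ d 0                             ∎
    where d = des σ

  countDes-insertMin-suc : ∀ σ i → countDes (insertMin σ) (suc i) + i * δ (des σ) i
                           ≡ suc (suc i) * δ (des σ) (suc i) + length σ * δ (des σ) i
  countDes-insertMin-suc σ i = begin
    countDes (insertMin σ) (suc i) + i * δ d i
      ≡⟨ cong (_+ i * δ d i) (countDes-insertMin σ (suc i)) ⟩
    δ d (suc i) + d * δ d (suc i) + asc σ * δ d i + i * δ d i
      ≡⟨ cong₂ (λ u v → δ d (suc i) + u + asc σ * δ d i + v) (δ-weight d (suc i)) (sym (δ-weight d i)) ⟩
    suc (suc i) * δ d (suc i) + asc σ * δ d i + d * δ d i
      ≡⟨ collect (suc (suc i) * δ d (suc i)) (asc σ) d (δ d i) ⟩
    suc (suc i) * δ d (suc i) + (d + asc σ) * δ d i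
      ≡⟨ cong (λ n → suc (suc i) * δ d (suc i) + n * δ d i) (des+asc≡length σ) ⟩
    suc (suc i) * δ d (suc i) + length σ * δ d i ∎
    where
    d = des σ
    collect : ∀ x a b y → x + a * y + b * y ≡ x + (b + a) * y
    collect = solve-∀

  countDes-Sym-suc-zero : ∀ k → countDes (Sym (suc k)) 0 ≡ countDes (Sym k) 0
  countDes-Sym-suc-zero k = trans (cong (λ L → countDes L 0) (Sym-suc k)) (go (Sym k))
    where
    go : ∀ L → countDes (concatMap insertMin L) 0 ≡ countDes L 0
    go []      = refl
    go (σ ∷ L) = begin
      countDes (insertMin σ ++ concatMap insertMin L) 0             ≡⟨ countDes-++ (insertMin σ) _ 0 ⟩
      countDes (insertMin σ) 0 + countDes (concatMap insertMin L) 0 ≡⟨ cong₂ _+_ (countDes-insertMin-zero σ) (go L) ⟩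
      δ (des σ) 0 + countDes L 0                                    ≡⟨ countDes-∷ σ L 0 ⟨
      countDes (σ ∷ L) 0                                            ∎

  countDes-Sym-suc : ∀ k i → countDes (Sym (suc k)) (suc i) + i * countDes (Sym k) i
                     ≡ suc (suc i) * countDes (Sym k) (suc i) + k * countDes (Sym k) i
  countDes-Sym-suc k i =
    trans (cong (λ L → countDes L (suc i) + i * countDes (Sym k) i) (Sym-suc k)) (go (Sym k) (Sym-length k))
    where
    go : ∀ L → All (λ σ → length σ ≡ k) L → countDes (concatMap insertMin L) (suc i) + i * countDes L i
                                            ≡ suc (suc i) * countDes L (suc i) + k * countDes L i
    go []      []             = trans (*-zeroʳ i) (sym (cong₂ _+_ (*-zeroʳ (suc (suc i))) (*-zeroʳ k)))
    go (σ ∷ L) (refl ∷ σs≡k) = begin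
      countDes (insertMin σ ++ concatMap insertMin L) (suc i) + i * countDes (σ ∷ L) i
        ≡⟨ cong₂ (λ u v → u + i * v) (countDes-++ (insertMin σ) _ (suc i)) (countDes-∷ σ L i) ⟩
      (p + q) + i * (x + y)
        ≡⟨ interchange p q x y i ⟩
      (p + i * x) + (q + i * y)
        ≡⟨ cong₂ _+_ (countDes-insertMin-suc σ i) (go L σs≡k) ⟩
      (s * x′ + k * x) + (s * y′ + k * y)
        ≡⟨ factor s k x′ y′ x y ⟩
      s * (x′ + y′) + k * (x + y)
        ≡⟨ cong₂ (λ u v → s * u + k * v) (countDes-∷ σ L (suc i)) (countDes-∷ σ L i) ⟨
      s * countDes (σ ∷ L) (suc i) + k * countDes (σ ∷ L) i ∎
      where
      p = countDes (insertMin σ) (suc i)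
      q = countDes (concatMap insertMin L) (suc i)
      x = δ (des σ) i
      y = countDes L i
      x′ = δ (des σ) (suc i)
      y′ = countDes L (suc i)
      s = suc (suc i)
      interchange : ∀ p q x y i → (p + q) + i * (x + y) ≡ (p + i * x) + (q + i * y)
      interchange = solve-∀
      factor : ∀ s k a b c d → (s * a + k * c) + (s * b + k * d) ≡ s * (a + b) + k * (c + d)
      factor = solve-∀

module Coefficients where

  open import Data.Nat using (ℕ; zero; suc; _∸_)
  import Data.Nat as ℕ
  import Data.Nat.Properties as ℕ
  open import Data.Nat.Combinatorics using (_C_; nC1≡n; nCk+nC[k+1]≡[n+1]C[k+1]; k>n⇒nCk≡0)
  open import Data.Integer using (ℤ; +_; _+_; _-_; _*_; -_)
  open import Data.Integer.Properties
    using (pos-+; pos-*; +-identityˡ; +-identityʳ; +-assoc; *-identityˡ; *-zeroʳ; *-assoc; *-distribˡ-+; *-distribʳ-+)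
  open import Data.Integer.Tactic.RingSolver using (solve-∀)
  open import Relation.Binary.PropositionalEquality
  open ≡-Reasoning
  open Descents using (countDes; countDes-Sym-suc-zero; countDes-Sym-suc)

  A-rec-zero : ∀ k → A (suc k) 0 ≡ A k 0
  A-rec-zero k = cong +_ (countDes-Sym-suc-zero k)

  A-rec-suc : ∀ k i → A (suc k) (suc i) ≡ + suc (suc i) * A k (suc i) + (+ k - + i) * A k i
  A-rec-suc k i = begin
    A (suc k) (suc i)                                          ≡⟨ x≡x+y-y (A (suc k) (suc i)) (+ i * A k i) ⟩
    A (suc k) (suc i) + + i * A k i - + i * A k i              ≡⟨ cong (_- + i * A k i) without-subtraction ⟩
    + suc (suc i) * A k (suc i) + + k * A k i - + i * A k i    ≡⟨ collect (+ suc (suc i) * A k (suc i)) (+ k) (+ i) (A k i) ⟩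
    + suc (suc i) * A k (suc i) + (+ k - + i) * A k i          ∎
    where
    x≡x+y-y : ∀ x y → x ≡ x + y - y
    x≡x+y-y = solve-∀
    collect : ∀ x k i a → x + k * a - i * a ≡ x + (k - i) * a
    collect = solve-∀
    pos-+-* : ∀ a b c → + (a ℕ.+ b ℕ.* c) ≡ + a + + b * + c
    pos-+-* a b c = trans (pos-+ a (b ℕ.* c)) (cong (λ t → + a + t) (pos-* b c))
    without-subtraction : A (suc k) (suc i) + + i * A k i ≡ + suc (suc i) * A k (suc i) + + k * A k i
    without-subtraction = begin
      + c′ + + i * + c₀                  ≡⟨ pos-+-* c′ i c₀ ⟨
      + (c′ ℕ.+ i ℕ.* c₀)                ≡⟨ cong +_ (countDes-Sym-suc k i) ⟩
      + (suc (suc i) ℕ.* c₁ ℕ.+ k ℕ.* c₀) ≡⟨ pos-+-* (suc (suc i) ℕ.* c₁) k c₀ ⟩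
      + (suc (suc i) ℕ.* c₁) + + k * + c₀ ≡⟨ cong (_+ + k * + c₀) (pos-* (suc (suc i)) c₁) ⟩
      + suc (suc i) * + c₁ + + k * + c₀  ∎
      where
      c′ = countDes (Sym (suc k)) (suc i)
      c₁ = countDes (Sym k) (suc i)
      c₀ = countDes (Sym k) i

  ∑₁ : ℕ → (ℕ → ℤ) → ℤ
  ∑₁ zero    g = + 0
  ∑₁ (suc n) g = ∑₁ n g + g (suc n)

  Σ₁-coeff : ∀ n f j → Σ₁ n f j ≡ ∑₁ n (λ k → f k j)
  Σ₁-coeff zero    f j = refl
  Σ₁-coeff (suc n) f j = cong (_+ f (suc n) j) (Σ₁-coeff n f j)

  ∑₁-cong : ∀ n {f g} → (∀ k → f (suc k) ≡ g (suc k)) → ∑₁ n f ≡ ∑₁ n g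
  ∑₁-cong zero    f≡g = refl
  ∑₁-cong (suc n) f≡g = cong₂ _+_ (∑₁-cong n f≡g) (f≡g n)

  ∑₁-+ : ∀ n f g → ∑₁ n (λ k → f k + g k) ≡ ∑₁ n f + ∑₁ n g
  ∑₁-+ zero    f g = refl
  ∑₁-+ (suc n) f g = trans (cong (_+ (f (suc n) + g (suc n))) (∑₁-+ n f g)) (interchange (∑₁ n f) (∑₁ n g) _ _)
    where
    interchange : ∀ a b c d → a + b + (c + d) ≡ a + c + (b + d)
    interchange = solve-∀

  ∑₁-scale : ∀ n c f → ∑₁ n (λ k → c * f k) ≡ c * ∑₁ n f
  ∑₁-scale zero    c f = sym (*-zeroʳ c)
  ∑₁-scale (suc n) c f = trans (cong (_+ c * f (suc n)) (∑₁-scale n c f)) (sym (*-distribˡ-+ c (∑₁ n f) (f (suc n))))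

  ∑₁-shift : ∀ n f → ∑₁ (suc n) f ≡ f 1 + ∑₁ n (λ k → f (suc k))
  ∑₁-shift zero    f = trans (+-identityˡ (f 1)) (sym (+-identityʳ (f 1)))
  ∑₁-shift (suc n) f = trans (cong (_+ f (suc (suc n))) (∑₁-shift n f)) (+-assoc (f 1) _ _)

  [k+1]*[n+1]C[k+1]≡[n+1]*nCk : ∀ n k → suc k ℕ.* (suc n C suc k) ≡ suc n ℕ.* (n C k)
  [k+1]*[n+1]C[k+1]≡[n+1]*nCk zero    zero    = refl
  [k+1]*[n+1]C[k+1]≡[n+1]*nCk zero    (suc k) = ℕ.*-zeroʳ (suc (suc k))
  [k+1]*[n+1]C[k+1]≡[n+1]*nCk (suc n) zero    =
    trans (ℕ.+-identityʳ _) (trans (nC1≡n (suc (suc n))) (sym (ℕ.*-identityʳ (suc (suc n)))))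
  [k+1]*[n+1]C[k+1]≡[n+1]*nCk (suc n) (suc k) = begin
    suc (suc k) ℕ.* (suc (suc n) C suc (suc k))
      ≡⟨ cong (suc (suc k) ℕ.*_) (nCk+nC[k+1]≡[n+1]C[k+1] (suc n) (suc k)) ⟨
    suc (suc k) ℕ.* (c ℕ.+ c′)
      ≡⟨ trans (ℕ.*-distribˡ-+ (suc (suc k)) c c′) (ℕ.+-assoc c _ _) ⟩
    c ℕ.+ (suc k ℕ.* c ℕ.+ suc (suc k) ℕ.* c′)
      ≡⟨ cong (c ℕ.+_) (cong₂ ℕ._+_ ([k+1]*[n+1]C[k+1]≡[n+1]*nCk n k) ([k+1]*[n+1]C[k+1]≡[n+1]*nCk n (suc k))) ⟩
    c ℕ.+ (suc n ℕ.* (n C k) ℕ.+ suc n ℕ.* (n C suc k))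
      ≡⟨ cong (c ℕ.+_) (ℕ.*-distribˡ-+ (suc n) (n C k) (n C suc k)) ⟨
    c ℕ.+ suc n ℕ.* (n C k ℕ.+ n C suc k)
      ≡⟨ cong (λ t → c ℕ.+ suc n ℕ.* t) (nCk+nC[k+1]≡[n+1]C[k+1] n k) ⟩
    suc (suc n) ℕ.* c ∎
    where
    c  = suc n C suc k
    c′ = suc n C suc (suc k)

  binomialSum : ℕ → (ℕ → ℤ) → ℤ
  binomialSum n g = ∑₁ n (λ k → + (n C k) * g k)

  binomialSum-cong : ∀ n {g h} → (∀ k → g k ≡ h k) → binomialSum n g ≡ binomialSum n h
  binomialSum-cong n g≡h = ∑₁-cong n (λ k → cong (+ (n C suc k) *_) (g≡h (suc k)))

  binomialSum-pascal : ∀ n g → binomialSum (suc n) g ≡ binomialSum n g + (g 1 + binomialSum n (λ k → g (suc k)))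
  binomialSum-pascal n g = begin
    binomialSum (suc n) g
      ≡⟨ ∑₁-cong (suc n) pascal ⟩
    ∑₁ (suc n) (λ k → + (n C k) * g k + + (n C (k ∸ 1)) * g k)
      ≡⟨ ∑₁-+ (suc n) _ _ ⟩
    ∑₁ (suc n) (λ k → + (n C k) * g k) + ∑₁ (suc n) (λ k → + (n C (k ∸ 1)) * g k)
      ≡⟨ cong₂ _+_ last-term-vanishes (∑₁-shift n _) ⟩
    binomialSum n g + (+ 1 * g 1 + binomialSum n (λ k → g (suc k)))
      ≡⟨ cong (λ t → binomialSum n g + (t + binomialSum n (λ k → g (suc k)))) (*-identityˡ (g 1)) ⟩
    binomialSum n g + (g 1 + binomialSum n (λ k → g (suc k))) ∎
    where
    pascal : ∀ k → + (suc n C suc k) * g (suc k) ≡ + (n C suc k) * g (suc k) + + (n C k) * g (suc k)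
    pascal k = begin
      + (suc n C suc k) * g (suc k)
        ≡⟨ cong (λ c → + c * g (suc k)) (trans (ℕ.+-comm (n C suc k) (n C k)) (nCk+nC[k+1]≡[n+1]C[k+1] n k)) ⟨
      + (n C suc k ℕ.+ n C k) * g (suc k)
        ≡⟨ cong (_* g (suc k)) (pos-+ (n C suc k) (n C k)) ⟩
      (+ (n C suc k) + + (n C k)) * g (suc k)
        ≡⟨ *-distribʳ-+ (g (suc k)) (+ (n C suc k)) (+ (n C k)) ⟩
      + (n C suc k) * g (suc k) + + (n C k) * g (suc k) ∎
    last-term-vanishes : ∑₁ (suc n) (λ k → + (n C k) * g k) ≡ binomialSum n g
    last-term-vanishes = begin
      binomialSum n g + + (n C suc n) * g (suc n) ≡⟨ cong (λ c → binomialSum n g + + c * g (suc n)) (k>n⇒nCk≡0 (ℕ.n<1+n n)) ⟩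
      binomialSum n g + + 0                       ≡⟨ +-identityʳ (binomialSum n g) ⟩
      binomialSum n g                             ∎

  binomialSum-weighted : ∀ n g → ∑₁ n (λ k → + k * (+ (n C k) * g k)) ≡ + n * (binomialSum n g - binomialSum (n ∸ 1) g)
  binomialSum-weighted zero    g = refl
  binomialSum-weighted (suc n) g = begin
    ∑₁ (suc n) (λ k → + k * (+ (suc n C k) * g k))
      ≡⟨ ∑₁-shift n _ ⟩
    + 1 * (+ (suc n C 1) * g 1) + ∑₁ n (λ k → + suc k * (+ (suc n C suc k) * g (suc k)))
      ≡⟨ cong₂ _+_ (cong (λ c → + 1 * (+ c * g 1)) (nC1≡n (suc n))) (∑₁-cong n (λ k → absorb (suc k))) ⟩
    + 1 * (+ suc n * g 1) + ∑₁ n (λ k → + suc n * (+ (n C k) * g (suc k)))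
      ≡⟨ cong (λ t → + 1 * (+ suc n * g 1) + t) (∑₁-scale n (+ suc n) _) ⟩
    + 1 * (+ suc n * g 1) + + suc n * binomialSum n (λ k → g (suc k))
      ≡⟨ factor (+ suc n) (g 1) (binomialSum n (λ k → g (suc k))) ⟩
    + suc n * (g 1 + binomialSum n (λ k → g (suc k)))
      ≡⟨ cong (+ suc n *_) (trans (y≡x+y-x (binomialSum n g) _) (sym (cong (_- binomialSum n g) (binomialSum-pascal n g)))) ⟩
    + suc n * (binomialSum (suc n) g - binomialSum n g) ∎
    where
    factor : ∀ m a b → + 1 * (m * a) + m * b ≡ m * (a + b)
    factor = solve-∀
    y≡x+y-x : ∀ x y → y ≡ x + y - x
    y≡x+y-x = solve-∀
    absorb : ∀ k → + suc k * (+ (suc n C suc k) * g (suc k)) ≡ + suc n * (+ (n C k) * g (suc k))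
    absorb k = begin
      + suc k * (+ (suc n C suc k) * g (suc k))  ≡⟨ *-assoc (+ suc k) (+ (suc n C suc k)) (g (suc k)) ⟨
      + suc k * + (suc n C suc k) * g (suc k)    ≡⟨ cong (_* g (suc k)) (pos-* (suc k) (suc n C suc k)) ⟨
      + (suc k ℕ.* (suc n C suc k)) * g (suc k)  ≡⟨ cong (λ c → + c * g (suc k)) ([k+1]*[n+1]C[k+1]≡[n+1]*nCk n k) ⟩
      + (suc n ℕ.* (n C k)) * g (suc k)          ≡⟨ cong (_* g (suc k)) (pos-* (suc n) (n C k)) ⟩
      + suc n * + (n C k) * g (suc k)            ≡⟨ *-assoc (+ suc n) (+ (n C k)) (g (suc k)) ⟩
      + suc n * (+ (n C k) * g (suc k))          ∎

  binomialA : ℕ → ℕ → ℤ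
  binomialA n i = binomialSum n (λ k → A k i)

  binomialA-suc-zero : ∀ n → binomialA (suc n) 0 ≡ + 1 + + 2 * binomialA n 0
  binomialA-suc-zero n = begin
    binomialA (suc n) 0                                          ≡⟨ binomialSum-pascal n (λ k → A k 0) ⟩
    binomialA n 0 + (+ 1 + binomialSum n (λ k → A (suc k) 0))    ≡⟨ cong (λ t → binomialA n 0 + (+ 1 + t)) (binomialSum-cong n A-rec-zero) ⟩
    binomialA n 0 + (+ 1 + binomialA n 0)                        ≡⟨ rearrange (binomialA n 0) ⟩
    + 1 + + 2 * binomialA n 0                                    ∎
    where
    rearrange : ∀ b → b + (+ 1 + b) ≡ + 1 + + 2 * b
    rearrange = solve-∀

  binomialA-suc-suc : ∀ n i → binomialA (suc n) (suc i)
                      ≡ (+ 3 + + i) * binomialA n (suc i) + (+ n - + i) * binomialA n i - + n * binomialA (n ∸ 1) i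
  binomialA-suc-suc n i = begin
    binomialA (suc n) (suc i)
      ≡⟨ binomialSum-pascal n (λ k → A k (suc i)) ⟩
    binomialA n (suc i) + (+ 0 + binomialSum n (λ k → A (suc k) (suc i)))
      ≡⟨ cong (λ t → binomialA n (suc i) + (+ 0 + t)) eulerian-step ⟩
    binomialA n (suc i) + (+ 0 + (p * binomialA n (suc i) + (+ n * (binomialA n i - binomialA (n ∸ 1) i) + - + i * binomialA n i)))
      ≡⟨ rearrange (binomialA n (suc i)) (binomialA n i) (binomialA (n ∸ 1) i) (+ n) (+ i) ⟩
    (+ 3 + + i) * binomialA n (suc i) + (+ n - + i) * binomialA n i - + n * binomialA (n ∸ 1) i ∎
    where
    p = + suc (suc i)
    rearrange : ∀ a b c n i → a + (+ 0 + ((+ 2 + i) * a + (n * (b - c) + - i * b))) ≡ (+ 3 + i) * a + (n - i) * b - n * c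
    rearrange = solve-∀
    expand : ∀ c p a k i b → c * (p * a + (k - i) * b) ≡ p * (c * a) + (k * (c * b) + - i * (c * b))
    expand = solve-∀
    eulerian-step : binomialSum n (λ k → A (suc k) (suc i))
                    ≡ p * binomialA n (suc i) + (+ n * (binomialA n i - binomialA (n ∸ 1) i) + - + i * binomialA n i)
    eulerian-step = begin
      binomialSum n (λ k → A (suc k) (suc i))
        ≡⟨ ∑₁-cong n (λ k → trans (cong (+ (n C suc k) *_) (A-rec-suc (suc k) i)) (expand (c (suc k)) p (A (suc k) (suc i)) (+ suc k) (+ i) (A (suc k) i))) ⟩
      ∑₁ n (λ k → p * (c k * A k (suc i)) + (+ k * (c k * A k i) + - + i * (c k * A k i)))
        ≡⟨ ∑₁-+ n _ _ ⟩
      ∑₁ n (λ k → p * (c k * A k (suc i))) + ∑₁ n (λ k → + k * (c k * A k i) + - + i * (c k * A k i))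
        ≡⟨ cong₂ _+_ (∑₁-scale n p _) (∑₁-+ n _ _) ⟩
      p * binomialA n (suc i) + (∑₁ n (λ k → + k * (c k * A k i)) + ∑₁ n (λ k → - + i * (c k * A k i)))
        ≡⟨ cong₂ (λ u v → p * binomialA n (suc i) + (u + v)) (binomialSum-weighted n (λ k → A k i)) (∑₁-scale n (- + i) _) ⟩
      p * binomialA n (suc i) + (+ n * (binomialA n i - binomialA (n ∸ 1) i) + - + i * binomialA n i) ∎
      where
      c : ℕ → ℤ
      c k = + (n C k)

  Ã-zero : ∀ n → Ã n 0 ≡ + 1
  Ã-zero zero    = refl
  Ã-zero (suc n) = refl

  Ã-suc : ∀ n i → Ã n (suc i) ≡ binomialA n i
  Ã-suc zero    i = refl
  Ã-suc (suc n) i = trans (+-identityˡ _) (Σ₁-coeff (suc n) (λ k → (+ (suc n C k)) · A k) i)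

  -- The coefficients of x and of x^(l+2) on both sides of the theorem, for n = m + 1.
  Ã-coeff-one : ∀ m → Ã (suc (suc m)) 1
                      ≡ Ã (suc m) 1 + (+ suc m + + 1) * Ã (suc m) 0 + (+ 1 * Ã (suc m) 1 - + 0) - + suc m * Ã m 0
  Ã-coeff-one m rewrite Ã-suc (suc (suc m)) 0 | Ã-suc (suc m) 0 | Ã-zero m =
    trans (binomialA-suc-zero (suc m)) (rearrange (binomialA (suc m) 0) (+ suc m))
    where
    rearrange : ∀ b n → + 1 + + 2 * b ≡ b + (n + + 1) * + 1 + (+ 1 * b - + 0) - n * + 1
    rearrange = solve-∀

  Ã-coeff-suc-suc : ∀ m l → Ã (suc (suc m)) (suc (suc l))
                            ≡ Ã (suc m) (suc (suc l)) + (+ suc m + + 1) * Ã (suc m) (suc l)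
                              + (+ suc (suc l) * Ã (suc m) (suc (suc l)) - + suc l * Ã (suc m) (suc l))
                              - + suc m * Ã m (suc l)
  Ã-coeff-suc-suc m l rewrite Ã-suc (suc (suc m)) (suc l) | Ã-suc (suc m) (suc l) | Ã-suc (suc m) l | Ã-suc m l =
    trans (binomialA-suc-suc (suc m) l)
          (rearrange (binomialA (suc m) (suc l)) (binomialA (suc m) l) (binomialA m l) (+ suc m) (+ l))
    where
    rearrange : ∀ a b c n l → (+ 3 + l) * a + (n - l) * b - n * c
                              ≡ a + (n + + 1) * b + ((+ 2 + l) * a - (+ 1 + l) * b) - n * c
    rearrange = solve-∀

open import Data.Nat using (ℕ; zero; suc; _≤_; _+_; _∸_)
open import Data.Integer using (+_)
open Coefficients using (Ã-coeff-one; Ã-coeff-suc-suc)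
open import Relation.Binary.PropositionalEquality using (refl)

corollary2p5 : ∀ (n : ℕ) → 1 ≤ n →
    Ã (suc n) ≗ₚ (((Ã n ⊕ X ((+ (n + 1)) · Ã n)) ⊕ (X (deriv (Ã n)) ⊖ X (X (deriv (Ã n))))) ⊖ X ((+ n) · Ã (n ∸ 1)))
corollary2p5 zero    ()
corollary2p5 (suc m) _ zero          = refl
corollary2p5 (suc m) _ (suc zero)    = Ã-coeff-one m
corollary2p5 (suc m) _ (suc (suc l)) = Ã-coeff-suc-suc m l
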